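{- Let $\mathbf{s}$ be a Sturmian word of slope $\theta$, and let $T_k,R_k,V_k,t_k$ ($k\ge -1$) be as in the context. Put $b^*_1=t_1$. For every $k\ge1$ there exists an integer $b^*_{k+1}$ with $0\le b^*_{k+1}\le a_{k+1}$ and $t_{k+1}=t_k+b^*_{k+1}q_k$. When $b^*_{k+1}=a_{k+1}$ we necessarily have $t_k<q_{k-1}$, so that $b^*_k=0$ and $t_k=t_{k-1}$ (with $t_0=0$). Moreover, for every $k\ge0$, $$T_{k+1}=M_k^{b^*_{k+1}}T_k=T_kV_k^{b^*_{k+1}},$$ and for every $k\ge1$, $$R_{k+1}=\begin{cases}R_kM_k^{a_{k+1}-b^*_{k+1}-1}M_{k-1}&\text{if } b^*_{k+1}<a_{k+1},\\ R_{k-1}&\text{if } b^*_{k+1}=a_{k+1}.\end{cases}$$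
   Context: Let $\theta=[0;a_1,a_2,\dots]\in(0,1)$ be irrational with convergent denominators $q_{ -1}=0$, $q_0=1$, $q_k=a_kq_{k-1}+q_{k-2}$. Words over $\{0,1\}$: $M_0=0$, $M_1=0^{a_1-1}1$, $M_k=M_{k-1}^{a_k}M_{k-2}$ ($k\ge2$), so $|M_k|=q_k$. A Sturmian word of slope $\theta$ is $s_1s_2\cdots$ or $s'_1s'_2\cdots$ for some $\rho\in[0,1)$, where $s_n=\lfloor n\theta+\rho\rfloor-\lfloor(n-1)\theta+\rho\rfloor$, $s'_n=\lceil n\theta+\rho\rceil-\lceil(n-1)\theta+\rho\rceil$. A word $V$ is a conjugate of $M_k$ if $V=RT$ and $M_k=TR$ for words $T,R$ with $0\le|T|<q_k$ (so $R$ is non-empty). For each $k\ge1$, $V_k$ denotes the conjugate of $M_k$ whose first $q_k-1$ letters coincide with the first $q_k-1$ letters of $\mathbf{s}$, and $T_k,R_k$ are the words with $V_k=R_kT_k$, $M_k=T_kR_k$, $R_k$ non-empty; $t_k=|T_k|$. Also $R_{ -1}=1$, $R_0=0$, $T_{ -1},T_0$ are empty, $V_{ -1}=1$, $V_0=0$, $t_0=0$. The sequence $(b^*_k)_{k\ge1}$ is called the formal intercept of $\mathbf{s}$. -}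

module Defs where

open import Data.Nat using (ℕ; zero; suc; _+_; _*_; _∸_; _≤_; _<_)
open import Data.Integer using (ℤ; +_) renaming (_-_ to _-ℤ_)
open import Data.Rational.Unnormalised using (ℚᵘ; mkℚᵘ) renaming (_<_ to _<ℚ_; _+_ to _+ℚ_)
open import Data.List using (List; []; _∷_; _++_; concat; replicate; length; take; applyUpTo)
open import Data.Product using (Σ; ∃; ∃₂; _×_)
open import Data.Sum using (_⊎_)
open import Relation.Nullary using (¬_)
open import Relation.Binary.PropositionalEquality using (_≡_; _≢_)

-- Words over {0,1}: lists of naturals (letters 0 and 1).
Word : Set
Word = List ℕ

_^ʷ_ : Word → ℕ → Word
w ^ʷ n = concat (replicate n w)

-- Partial quotients a : ℕ → ℕ, where a k (k ≥ 1) is a_k; a 0 is unused.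
-- Convergent denominators q_k (k ≥ 0): q_0 = 1, q_1 = a_1, q_{k+2} = a_{k+2} q_{k+1} + q_k
qd : (ℕ → ℕ) → ℕ → ℕ
qd a zero = 1
qd a (suc zero) = a 1
qd a (suc (suc k)) = a (suc (suc k)) * qd a (suc k) + qd a k

pn : (ℕ → ℕ) → ℕ → ℕ
pn a zero = 0
pn a (suc zero) = 1
pn a (suc (suc k)) = a (suc (suc k)) * pn a (suc k) + pn a k

M : (ℕ → ℕ) → ℕ → Word
M a zero = 0 ∷ []
M a (suc zero) = replicate (a 1 ∸ 1) 0 ++ 1 ∷ []
M a (suc (suc k)) = (M a (suc k) ^ʷ a (suc (suc k))) ++ M a k

ℤtoℚ : ℤ → ℚᵘ
ℤtoℚ z = mkℚᵘ z 0

-- Real numbers as (located) Dedekind lower cuts: L q means "q < x".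
record IsCut (L : ℚᵘ → Set) : Set where
  field
    inhabited : ∃ λ q → L q
    bounded   : ∃ λ q → ¬ L q
    downward  : ∀ {q r} → q <ℚ r → L r → L q
    rounded   : ∀ {q} → L q → ∃ λ r → q <ℚ r × L r
    located   : ∀ {q r} → q <ℚ r → L q ⊎ (∃ λ r' → r' <ℚ r × ¬ L r')

-- Lower cut of n·θ + ρ, where θ = [0; a_1, a_2, ...] is the supremum of the
-- even convergents p_{2j}/q_{2j}, and ρ is given by its lower cut.
X : (ℕ → ℕ) → (ℚᵘ → Set) → ℕ → ℚᵘ → Set
X a ρ n q = ∃₂ λ j r → ρ r ×
  q <ℚ (mkℚᵘ (+ (n * pn a (j + j))) (qd a (j + j) ∸ 1) +ℚ r)

FloorIs : (ℚᵘ → Set) → ℕ → Set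
FloorIs x m = (∀ q → q <ℚ ℤtoℚ (+ m) → x q) × (∃ λ q → q <ℚ ℤtoℚ (+ (suc m)) × ¬ x q)

CeilIs : (ℚᵘ → Set) → ℕ → Set
CeilIs x m = x (ℤtoℚ (+ m -ℤ + 1)) × ¬ x (ℤtoℚ (+ m))

-- A Sturmian word of slope θ = [0;a_1,a_2,...]; w i denotes the letter s_{i+1}.
Sturmian : (ℕ → ℕ) → (ℕ → ℕ) → Set₁
Sturmian a w = Σ (ℚᵘ → Set) λ ρ → IsCut ρ
  × (∀ q → q <ℚ ℤtoℚ (+ 0) → ρ q)
  × (∃ λ q → q <ℚ ℤtoℚ (+ 1) × ¬ ρ q)
  × ((∀ i → ∃₂ λ m m' → FloorIs (X a ρ (suc i)) m × FloorIs (X a ρ i) m' × w i + m' ≡ m)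
    ⊎ (∀ i → ∃₂ λ m m' → CeilIs (X a ρ (suc i)) m × CeilIs (X a ρ i) m' × w i + m' ≡ m))

-- (T , R) with M_k = T R, R non-empty, and the conjugate V_k = R T agreeing with
-- the first q_k - 1 letters of s.
IsVSplit : (ℕ → ℕ) → (ℕ → ℕ) → ℕ → Word → Word → Set
IsVSplit a w k T R = (M a k ≡ T ++ R) × (R ≢ []) × (take (qd a k ∸ 1) (R ++ T) ≡ applyUpTo w (qd a k ∸ 1))

-- Since the length q_k and the letter sum p_k of M_k are coprime, M_k is primitive, so its
-- rotations are pairwise distinct; they even differ within their first q_k - 1 letters, because
-- the letter sum then fixes the last letter.  Now V_k is the rotation of M_k by t_k.  Write
-- t_{k+1} = b q_k + r with r < q_k.  As M_{k+1} = M_k^{a_{k+1}} M_{k-1}, and M_{k-1} M_k agrees with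
-- M_k M_{k-1} on q_k + q_{k-1} - 2 letters, the rotation of M_{k+1} by t_{k+1} begins like the
-- rotation of M_k by r; both begin like the Sturmian word, hence r = t_k.  The bound
-- t_{k+1} < q_{k+1} = a_{k+1} q_k + q_{k-1} gives b <= a_{k+1}, with t_k < q_{k-1} if b = a_{k+1},
-- and cutting M_{k+1} at t_{k+1} yields T_{k+1} and R_{k+1}.

module Submission where

open import Defs
open import Data.Nat using (ℕ; zero; suc; _+_; _*_; _∸_; _≤_; _<_; s≤s; z≤n; _≤?_; NonZero; >-nonZero)
open import Data.Nat.DivMod using (_/_; _%_; m≡m%n+[m/n]*n; m%n<n)
open import Data.Nat.Properties
open import Data.Nat.ListAction using (sum)
open import Data.Nat.ListAction.Properties using (sum-++)
open import Data.Nat.Divisibility using (_∣_; divides; ∣⇒≤; ∣n⇒∣m*n; ∣m+n∣m⇒∣n; ∣1⇒≡1)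
open import Data.Nat.Coprimality using (Coprime; coprime-divisor)
open import Data.List using (List; []; _∷_; _++_; length; take; drop; replicate; applyUpTo)
open import Data.List.Properties
  using (length-++; ++-assoc; ++-identityʳ; ++-cancelˡ; ∷-injective; take++drop≡id; take-take;
         length-take; length-drop; length-replicate; length-++-comm; length-++-≤ˡ; length-++-≤ʳ; drop-drop; take-drop)
open import Data.Product using (Σ; ∃; _×_; _,_; proj₁; proj₂)
open import Data.Sum using (_⊎_; inj₁; inj₂)
open import Data.Empty using (⊥-elim)
open import Data.Nat.Tactic.RingSolver using (solve)
open import Relation.Nullary using (yes; no)
open import Relation.Binary.PropositionalEquality
open import Function using (_∘′_)
open import Relation.Binary using (tri<; tri≈; tri>)
open import Induction.WellFounded using (Acc; acc)
open import Data.Nat.Induction using (<-wellFounded)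

private
  variable
    A : Set

-- Prefixes of lists

take-++ˡ : ∀ n (X Y : List A) → n ≤ length X → take n (X ++ Y) ≡ take n X
take-++ˡ zero    X       Y _         = refl
take-++ˡ (suc n) (x ∷ X) Y (s≤s n≤X) = cong (x ∷_) (take-++ˡ n X Y n≤X)

drop-++ˡ : ∀ n (X Y : List A) → n ≤ length X → drop n (X ++ Y) ≡ drop n X ++ Y
drop-++ˡ zero    X       Y _         = refl
drop-++ˡ (suc n) (x ∷ X) Y (s≤s n≤X) = drop-++ˡ n X Y n≤X

take-length-+-++ : ∀ (X : List A) n Y → take (length X + n) (X ++ Y) ≡ X ++ take n Y
take-length-+-++ []      n Y = refl
take-length-+-++ (x ∷ X) n Y = cong (x ∷_) (take-length-+-++ X n Y)

drop-length-+-++ : ∀ (X : List A) n Y → drop (length X + n) (X ++ Y) ≡ drop n Y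
drop-length-+-++ []      n Y = refl
drop-length-+-++ (x ∷ X) n Y = drop-length-+-++ X n Y

take-length-++ : ∀ (X Y : List A) → take (length X) (X ++ Y) ≡ X
take-length-++ []      Y = refl
take-length-++ (x ∷ X) Y = cong (x ∷_) (take-length-++ X Y)

drop-length-++ : ∀ (X Y : List A) → drop (length X) (X ++ Y) ≡ Y
drop-length-++ []      Y = refl
drop-length-++ (x ∷ X) Y = drop-length-++ X Y

take-take-≤ : ∀ {m n} (X : List A) → m ≤ n → take m (take n X) ≡ take m X
take-take-≤ {m = m} {n} X m≤n = trans (take-take m n X) (cong (λ k → take k X) (m≤n⇒m⊓n≡m m≤n))

take-idem : ∀ n (X : List A) → take n (take n X) ≡ take n X
take-idem n X = take-take-≤ X ≤-refl

take-replicate-++ : ∀ {n c} (x : A) Y → n ≤ c → take n (replicate c x ++ Y) ≡ replicate n x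
take-replicate-++ {n = zero}              x Y _         = refl
take-replicate-++ {n = suc n} {suc c} x Y (s≤s n≤c) = cong (x ∷_) (take-replicate-++ x Y n≤c)

take-applyUpTo : ∀ (f : ℕ → A) {m n} → m ≤ n → take m (applyUpTo f n) ≡ applyUpTo f m
take-applyUpTo f {zero}            _         = refl
take-applyUpTo f {suc m} {suc n} (s≤s m≤n) = cong (f 0 ∷_) (take-applyUpTo (λ i → f (suc i)) m≤n)

++-injective-length : ∀ (X X′ Y Y′ : List A) → length X ≡ length X′ →
                      X ++ Y ≡ X′ ++ Y′ → X ≡ X′ × Y ≡ Y′
++-injective-length X X′ Y Y′ ∣X∣≡∣X′∣ eq = X≡X′ , ++-cancelˡ X′ Y Y′ (trans (cong (_++ Y) (sym X≡X′)) eq)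
  where
  open ≡-Reasoning
  X≡X′ : X ≡ X′
  X≡X′ = begin
    X                            ≡⟨ take-length-++ X Y ⟨
    take (length X) (X ++ Y)     ≡⟨ cong₂ take ∣X∣≡∣X′∣ eq ⟩
    take (length X′) (X′ ++ Y′)  ≡⟨ take-length-++ X′ Y′ ⟩
    X′                           ∎

++-prefix : ∀ (X Y : List A) {U V} → X ++ U ≡ Y ++ V → length X ≤ length Y → ∃ λ Z → Y ≡ X ++ Z
++-prefix []      Y       eq _ = Y , refl
++-prefix (x ∷ X) (y ∷ Y) eq (s≤s X≤Y) with ∷-injective eq
... | refl , eq′ with ++-prefix X Y eq′ X≤Y
...   | Z , refl = Z , refl

Agree : ℕ → List A → List A → Set
Agree n U V = take n U ≡ take n V

agree-≤ : ∀ {m n} {U V : List A} → m ≤ n → Agree n U V → Agree m U V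
agree-≤ {m = m} {n} {U} {V} m≤n U≈V =
  trans (sym (take-take-≤ U m≤n)) (trans (cong (take m) U≈V) (take-take-≤ V m≤n))

agree-++ˡ : ∀ (X : List A) {n U V} → Agree n U V → Agree (length X + n) (X ++ U) (X ++ V)
agree-++ˡ X {n} {U} {V} U≈V =
  trans (take-length-+-++ X n U) (trans (cong (X ++_) U≈V) (sym (take-length-+-++ X n V)))

agree-++ʳ : ∀ {n} (U V Y Z : List A) → n ≤ length U → n ≤ length V → Agree n U V → Agree n (U ++ Y) (V ++ Z)
agree-++ʳ {n = n} U V Y Z n≤U n≤V U≈V = trans (take-++ˡ n U Y n≤U) (trans U≈V (sym (take-++ˡ n V Z n≤V)))

agree-drop : ∀ r {n} {U V : List A} → Agree (r + n) U V → Agree n (drop r U) (drop r V)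
agree-drop r {n} {U} {V} U≈V = trans (take-drop n r U) (trans (cong (drop r) U≈V) (sym (take-drop n r V)))

-- Powers of words

^ʷ-+ : ∀ (W : Word) i j → W ^ʷ (i + j) ≡ (W ^ʷ i) ++ (W ^ʷ j)
^ʷ-+ W zero    j = refl
^ʷ-+ W (suc i) j = trans (cong (W ++_) (^ʷ-+ W i j)) (sym (++-assoc W (W ^ʷ i) (W ^ʷ j)))

length-^ʷ : ∀ (W : Word) i → length (W ^ʷ i) ≡ i * length W
length-^ʷ W zero    = refl
length-^ʷ W (suc i) = trans (length-++ W) (cong (length W +_) (length-^ʷ W i))

sum-^ʷ : ∀ (W : Word) i → sum (W ^ʷ i) ≡ i * sum W
sum-^ʷ W zero    = refl
sum-^ʷ W (suc i) = trans (sum-++ W (W ^ʷ i)) (cong (sum W +_) (sum-^ʷ W i))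

^ʷ-++-comm : ∀ (W : Word) i → (W ^ʷ i) ++ W ≡ W ++ (W ^ʷ i)
^ʷ-++-comm W zero    = sym (++-identityʳ W)
^ʷ-++-comm W (suc i) = trans (++-assoc W (W ^ʷ i) W) (cong (W ++_) (^ʷ-++-comm W i))

^ʷ-conjugate : ∀ (X Y : Word) j → ((X ++ Y) ^ʷ j) ++ X ≡ X ++ ((Y ++ X) ^ʷ j)
^ʷ-conjugate X Y zero    = sym (++-identityʳ X)
^ʷ-conjugate X Y (suc j) = begin
  ((X ++ Y) ++ ((X ++ Y) ^ʷ j)) ++ X  ≡⟨ ++-assoc (X ++ Y) _ X ⟩
  (X ++ Y) ++ (((X ++ Y) ^ʷ j) ++ X)  ≡⟨ cong ((X ++ Y) ++_) (^ʷ-conjugate X Y j) ⟩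
  (X ++ Y) ++ (X ++ ((Y ++ X) ^ʷ j))  ≡⟨ ++-assoc X Y _ ⟩
  X ++ (Y ++ (X ++ ((Y ++ X) ^ʷ j)))  ≡⟨ cong (X ++_) (++-assoc Y X _) ⟨
  X ++ ((Y ++ X) ++ ((Y ++ X) ^ʷ j))  ∎
  where open ≡-Reasoning

take-^ʷ-++ : ∀ (W Z : Word) {A n} → 1 ≤ A → n ≤ length W → take n ((W ^ʷ A) ++ Z) ≡ take n W
take-^ʷ-++ W Z {suc A} {n} _ n≤W = trans (cong (take n) (++-assoc W (W ^ʷ A) Z)) (take-++ˡ n W _ n≤W)

^ʷ-++-take-agree : ∀ (M : Word) j {r} → r ≤ length M → Agree r ((M ^ʷ j) ++ take r M) M
^ʷ-++-take-agree M zero    {r} _   = take-idem r M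
^ʷ-++-take-agree M (suc j) {r} r≤M =
  trans (cong (take r) (++-assoc M (M ^ʷ j) (take r M))) (take-++ˡ r M _ r≤M)

-- Commuting words and rotations

proportional-++ : ∀ (X Y : Word) → length Y * sum X ≡ length X * sum Y →
         length (X ++ Y) * sum X ≡ length X * sum (X ++ Y)
proportional-++ X Y h = begin
  length (X ++ Y) * sum X                    ≡⟨ cong (_* sum X) (length-++ X) ⟩
  (length X + length Y) * sum X              ≡⟨ *-distribʳ-+ (sum X) (length X) (length Y) ⟩
  length X * sum X + length Y * sum X        ≡⟨ cong (length X * sum X +_) h ⟩
  length X * sum X + length X * sum Y        ≡⟨ *-distribˡ-+ (length X) (sum X) (sum Y) ⟨
  length X * (sum X + sum Y)                 ≡⟨ cong (length X *_) (sum-++ X Y) ⟨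
  length X * sum (X ++ Y)                    ∎
  where open ≡-Reasoning

commute⇒proportional : ∀ (X Y : Word) → X ++ Y ≡ Y ++ X → length Y * sum X ≡ length X * sum Y
commute⇒proportional X Y = go X Y (<-wellFounded (length X + length Y))
  where
  shorter : ∀ x (X Y : Word) → length Y < length ((x ∷ X) ++ Y)
  shorter x X Y = s≤s (length-++-≤ʳ Y {X})

  go : ∀ X Y → Acc _<_ (length X + length Y) → X ++ Y ≡ Y ++ X → length Y * sum X ≡ length X * sum Y
  go []      Y  _        _ = *-zeroʳ (length Y)
  go (x ∷ X) [] _        _ = sym (*-zeroʳ (suc (length X)))
  go X₀@(x ∷ X) Y₀@(y ∷ Y) (acc rs) c with length X₀ ≤? length Y₀
  ... | yes X₀≤Y₀ with ++-prefix X₀ Y₀ c X₀≤Y₀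
  ...   | Y′ , refl = proportional-++ X₀ Y′ (go X₀ Y′ (rs (+-monoʳ-< (length X₀) (shorter x X Y′)))
                        (++-cancelˡ X₀ _ _ (trans c (++-assoc X₀ Y′ X₀))))
  go X₀@(x ∷ X) Y₀@(y ∷ Y) (acc rs) c | no X₀≰Y₀ with ++-prefix Y₀ X₀ (sym c) (<⇒≤ (≰⇒> X₀≰Y₀))
  ...   | X′ , refl = sym (proportional-++ Y₀ X′ (sym (go X′ Y₀ (rs (+-monoˡ-< (length Y₀) (shorter y Y X′)))
                        (sym (++-cancelˡ Y₀ _ _ (trans (sym c) (++-assoc Y₀ X′ Y₀)))))))

coprime⇒¬commuting-factors : ∀ (B Y : Word) → Coprime (length (B ++ Y)) (sum (B ++ Y)) →
                             0 < length B → 0 < length Y → B ++ Y ≢ Y ++ B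
coprime⇒¬commuting-factors B Y coprime 0<B 0<Y BY≡YB =
  <-irrefl refl (<-≤-trans B<BY (∣⇒≤ ⦃ >-nonZero 0<B ⦄ (coprime-divisor coprime BY∣sumBY*B)))
  where
  open ≡-Reasoning
  B<BY : length B < length (B ++ Y)
  B<BY = subst (length B <_) (sym (length-++ B)) (m<m+n (length B) 0<Y)
  BY∣sumBY*B = divides (sum B) (begin
    sum (B ++ Y) * length B      ≡⟨ *-comm (sum (B ++ Y)) (length B) ⟩
    length B * sum (B ++ Y)      ≡⟨ proportional-++ B Y (commute⇒proportional B Y BY≡YB) ⟨
    length (B ++ Y) * sum B      ≡⟨ *-comm (length (B ++ Y)) (sum B) ⟩
    sum B * length (B ++ Y)      ∎)

rotate : ℕ → List A → List A
rotate r W = drop r W ++ take r W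

length-rotate : ∀ r (W : List A) → length (rotate r W) ≡ length W
length-rotate r W = trans (length-++-comm (drop r W) (take r W)) (cong length (take++drop≡id r W))

sum-rotate : ∀ r (W : Word) → sum (rotate r W) ≡ sum W
sum-rotate r W = begin
  sum (drop r W ++ take r W)        ≡⟨ sum-++ (drop r W) (take r W) ⟩
  sum (drop r W) + sum (take r W)   ≡⟨ +-comm (sum (drop r W)) _ ⟩
  sum (take r W) + sum (drop r W)   ≡⟨ sum-++ (take r W) (drop r W) ⟨
  sum (take r W ++ drop r W)        ≡⟨ cong sum (take++drop≡id r W) ⟩
  sum W                             ∎
  where open ≡-Reasoning

rotate-length-++ : ∀ (T R : List A) → rotate (length T) (T ++ R) ≡ R ++ T
rotate-length-++ T R = cong₂ _++_ (drop-length-++ T R) (take-length-++ T R)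

rotate-length-+-++ : ∀ (P Q S : List A) {r} → r ≤ length Q →
                     rotate (length P + r) (P ++ Q ++ S) ≡ drop r Q ++ S ++ P ++ take r Q
rotate-length-+-++ P Q S {r} r≤Q = begin
  drop (length P + r) (P ++ Q ++ S) ++ take (length P + r) (P ++ Q ++ S)
    ≡⟨ cong₂ _++_ (drop-length-+-++ P r (Q ++ S)) (take-length-+-++ P r (Q ++ S)) ⟩
  drop r (Q ++ S) ++ P ++ take r (Q ++ S)
    ≡⟨ cong₂ (λ U V → U ++ P ++ V) (drop-++ˡ r Q S r≤Q) (take-++ˡ r Q S r≤Q) ⟩
  (drop r Q ++ S) ++ P ++ take r Q
    ≡⟨ ++-assoc (drop r Q) S _ ⟩
  drop r Q ++ S ++ P ++ take r Q
    ∎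
  where open ≡-Reasoning

rotate-length-++-++ : ∀ (P B C : List A) → rotate (length P + length B) (P ++ B ++ C) ≡ (C ++ P) ++ B
rotate-length-++-++ P B C = begin
  drop (length P + length B) (P ++ B ++ C) ++ take (length P + length B) (P ++ B ++ C)
    ≡⟨ cong₂ _++_ (drop-length-+-++ P (length B) (B ++ C)) (take-length-+-++ P (length B) (B ++ C)) ⟩
  drop (length B) (B ++ C) ++ P ++ take (length B) (B ++ C)
    ≡⟨ cong₂ (λ U V → U ++ P ++ V) (drop-length-++ B C) (take-length-++ B C) ⟩
  C ++ P ++ B
    ≡⟨ ++-assoc C P B ⟨
  (C ++ P) ++ B
    ∎
  where open ≡-Reasoning

rotate-< : ∀ (W : Word) {r r′} → Coprime (length W) (sum W) → r < r′ → r′ < length W →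
           rotate r W ≢ rotate r′ W
rotate-< W {r} {r′} coprime r<r′ r′<W rW≡r′W =
  coprime⇒¬commuting-factors B (C ++ P) coprime′ 0<B 0<CP (begin
    B ++ C ++ P                            ≡⟨ BCP≡rW ⟩
    rotate r W                             ≡⟨ rW≡r′W ⟩
    rotate r′ W                            ≡⟨ cong₂ rotate ∣P∣+∣B∣≡r′ (sym W≡PBC) ⟨
    rotate (length P + length B) (P ++ B ++ C) ≡⟨ rotate-length-++-++ P B C ⟩
    (C ++ P) ++ B                          ∎)
  where
  open ≡-Reasoning
  δ = r′ ∸ r
  P = take r W
  B = take δ (drop r W)
  C = drop δ (drop r W)
  W≡PBC : W ≡ P ++ B ++ C
  W≡PBC = sym (trans (cong (P ++_) (take++drop≡id δ (drop r W))) (take++drop≡id r W))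
  r+δ≡r′ : r + δ ≡ r′
  r+δ≡r′ = m+[n∸m]≡n (<⇒≤ r<r′)
  ∣P∣≡r : length P ≡ r
  ∣P∣≡r = trans (length-take r W) (m≤n⇒m⊓n≡m (<⇒≤ (<-trans r<r′ r′<W)))
  ∣B∣≡δ : length B ≡ δ
  ∣B∣≡δ = trans (length-take δ (drop r W))
            (m≤n⇒m⊓n≡m (subst (δ ≤_) (sym (length-drop r W)) (∸-monoˡ-≤ r (<⇒≤ r′<W))))
  ∣P∣+∣B∣≡r′ : length P + length B ≡ r′
  ∣P∣+∣B∣≡r′ = trans (cong₂ _+_ ∣P∣≡r ∣B∣≡δ) r+δ≡r′
  0<B : 0 < length B
  0<B = subst (0 <_) (sym ∣B∣≡δ) (m<n⇒0<n∸m r<r′)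
  0<CP : 0 < length (C ++ P)
  0<CP = ≤-trans (subst (0 <_) (sym ∣C∣) (m<n⇒0<n∸m r′<W)) (length-++-≤ˡ C)
    where
    ∣C∣ : length C ≡ length W ∸ r′
    ∣C∣ = trans (cong length (drop-drop r δ W)) (trans (length-drop (r + δ) W) (cong (length W ∸_) r+δ≡r′))
  BCP≡rW : B ++ C ++ P ≡ rotate r W
  BCP≡rW = trans (sym (++-assoc B C P))
             (trans (sym (rotate-length-++ P (B ++ C))) (cong₂ rotate ∣P∣≡r (sym W≡PBC)))
  coprime′ : Coprime (length (B ++ C ++ P)) (sum (B ++ C ++ P))
  coprime′ = subst₂ Coprime (trans (sym (length-rotate r W)) (cong length (sym BCP≡rW)))
                            (trans (sym (sum-rotate r W)) (cong sum (sym BCP≡rW))) coprime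

rotate-injective : ∀ (W : Word) {r r′} → Coprime (length W) (sum W) → r < length W → r′ < length W →
                   rotate r W ≡ rotate r′ W → r ≡ r′
rotate-injective W {r} {r′} coprime r<W r′<W eq with <-cmp r r′
... | tri< r<r′ _ _ = ⊥-elim (rotate-< W coprime r<r′ r′<W eq)
... | tri≈ _ r≡r′ _ = r≡r′
... | tri> _ _ r′<r = ⊥-elim (rotate-< W coprime r′<r r<W (sym eq))

init-sum⇒≡ : ∀ (X Y : Word) → length X ≡ length Y → Agree (length X ∸ 1) X Y → sum X ≡ sum Y → X ≡ Y
init-sum⇒≡ []                []      _ _ _ = refl
init-sum⇒≡ (x ∷ [])          (y ∷ []) _ _ x+0≡y+0 = cong (_∷ []) (+-cancelʳ-≡ 0 x y x+0≡y+0)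
init-sum⇒≡ (x ∷ X@(_ ∷ _))   (y ∷ Y)  ∣X∣≡∣Y∣ X≈Y sumX≡sumY with ∷-injective X≈Y
... | refl , X≈′Y = cong (x ∷_) (init-sum⇒≡ X Y (suc-injective ∣X∣≡∣Y∣) X≈′Y (+-cancelˡ-≡ x _ _ sumX≡sumY))

rotate-prefix-injective : ∀ (W : Word) {r r′} → Coprime (length W) (sum W) → r < length W → r′ < length W →
                          Agree (length W ∸ 1) (rotate r W) (rotate r′ W) → r ≡ r′
rotate-prefix-injective W {r} {r′} coprime r<W r′<W rW≈r′W =
  rotate-injective W coprime r<W r′<W
    (init-sum⇒≡ (rotate r W) (rotate r′ W) (trans (length-rotate r W) (sym (length-rotate r′ W)))
      (subst (λ n → Agree (n ∸ 1) (rotate r W) (rotate r′ W)) (sym (length-rotate r W)) rW≈r′W)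
      (trans (sum-rotate r W) (sym (sum-rotate r′ W))))

-- Rotations of M^A N

<⇒≤∸1 : ∀ {r q} → r < q → r ≤ q ∸ 1
<⇒≤∸1 (s≤s r≤q-1) = r≤q-1

+∸2 : ∀ {q q′} → 0 < q → 0 < q′ → q + q′ ∸ 2 ≡ (q ∸ 1) + (q′ ∸ 1)
+∸2 {suc n} {suc n′} _ _ = cong (_∸ 1) (+-suc n n′)

rotate-^ʷ-++-inner : ∀ (M N : Word) {A j r} → 0 < length N →
                     Agree (length M + length N ∸ 2) (N ++ M) (M ++ N) →
                     j < A → r < length M →
                     Agree (length M ∸ 1) (rotate (j * length M + r) ((M ^ʷ A) ++ N)) (rotate r M)
rotate-^ʷ-++-inner M N {A} {j} {r} 0<N NM≈MN j<A r<M with m≤n⇒∃[o]m+o≡n j<A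
... | e , 1+j+e≡A = subst (λ U → Agree (length M ∸ 1) U (rotate r M)) (sym rotation) conclusion
  where
  open ≡-Reasoning
  r≤M = <⇒≤ r<M
  Z = (M ^ʷ j) ++ take r M
  Rest = ((M ^ʷ e) ++ N) ++ Z

  rotation : rotate (j * length M + r) ((M ^ʷ A) ++ N) ≡ drop r M ++ Rest
  rotation = begin
    rotate (j * length M + r) ((M ^ʷ A) ++ N)
      ≡⟨ cong₂ rotate (cong (_+ r) (sym (length-^ʷ M j)))
           (cong (λ i → (M ^ʷ i) ++ N) (trans (sym 1+j+e≡A) (sym (+-suc j e)))) ⟩
    rotate (length (M ^ʷ j) + r) ((M ^ʷ (j + suc e)) ++ N)
      ≡⟨ cong (λ U → rotate (length (M ^ʷ j) + r) (U ++ N)) (^ʷ-+ M j (suc e)) ⟩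
    rotate (length (M ^ʷ j) + r) (((M ^ʷ j) ++ M ++ (M ^ʷ e)) ++ N)
      ≡⟨ cong (rotate (length (M ^ʷ j) + r))
           (trans (++-assoc (M ^ʷ j) _ N) (cong ((M ^ʷ j) ++_) (++-assoc M (M ^ʷ e) N))) ⟩
    rotate (length (M ^ʷ j) + r) ((M ^ʷ j) ++ M ++ (M ^ʷ e) ++ N)
      ≡⟨ rotate-length-+-++ (M ^ʷ j) M ((M ^ʷ e) ++ N) r≤M ⟩
    drop r M ++ Rest
      ∎

  Rest≈M : ∀ e → Agree r (((M ^ʷ e) ++ N) ++ Z) M
  Rest≈M (suc e′) = trans (cong (take r) (trans (++-assoc (M ++ (M ^ʷ e′)) N Z)
                                           (++-assoc M (M ^ʷ e′) (N ++ Z))))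
                          (take-++ˡ r M _ r≤M)
  Rest≈M zero = begin
    take r (N ++ Z)   ≡⟨ agree-≤ (m≤n+m r (length N)) (agree-++ˡ N (^ʷ-++-take-agree M j r≤M)) ⟩
    take r (N ++ M)   ≡⟨ agree-≤ r≤MN NM≈MN ⟩
    take r (M ++ N)   ≡⟨ take-++ˡ r M N r≤M ⟩
    take r M          ∎
    where
    r≤MN : r ≤ length M + length N ∸ 2
    r≤MN = subst (r ≤_) (sym (+∸2 (≤-<-trans z≤n r<M) 0<N))
             (≤-trans (<⇒≤∸1 r<M) (m≤m+n (length M ∸ 1) _))

  conclusion : Agree (length M ∸ 1) (drop r M ++ Rest) (rotate r M)
  conclusion = agree-≤ (≤-trans (m∸n≤m (length M) 1)
                         (≤-reflexive (sym (trans (cong (_+ r) (length-drop r M)) (m∸n+n≡m r≤M)))))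
                 (agree-++ˡ (drop r M) (trans (Rest≈M e) (sym (take-idem r M))))

rotate-^ʷ-++-tail : ∀ (M N : Word) {A r} → 1 ≤ A →
                    Agree (length M + length N ∸ 2) (N ++ M) (M ++ N) →
                    Agree (length N ∸ 1) M N →
                    r < length M → r < length N →
                    Agree (length M ∸ 1) (rotate (A * length M + r) ((M ^ʷ A) ++ N)) (rotate r M)
rotate-^ʷ-++-tail M N {suc A} {r} _ NM≈MN M≈N r<M r<N =
  subst (λ U → Agree (length M ∸ 1) U (rotate r M)) (sym rotation) (trans step₁ step₂)
  where
  r≤N = <⇒≤ r<N
  r≤M = <⇒≤ r<M
  Y = (M ^ʷ A) ++ take r N

  rotation : rotate (suc A * length M + r) ((M ^ʷ suc A) ++ N) ≡ drop r N ++ M ++ Y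
  rotation = begin
    rotate (suc A * length M + r) ((M ^ʷ suc A) ++ N)
      ≡⟨ cong₂ rotate (cong (_+ r) (sym (length-^ʷ M (suc A))))
                      (cong ((M ^ʷ suc A) ++_) (sym (++-identityʳ N))) ⟩
    rotate (length (M ^ʷ suc A) + r) ((M ^ʷ suc A) ++ N ++ [])
      ≡⟨ rotate-length-+-++ (M ^ʷ suc A) N [] r≤N ⟩
    drop r N ++ (M ++ (M ^ʷ A)) ++ take r N
      ≡⟨ cong (drop r N ++_) (++-assoc M (M ^ʷ A) (take r N)) ⟩
    drop r N ++ M ++ Y
      ∎
    where open ≡-Reasoning

  shifted : Agree (length M ∸ 1) (drop r N ++ M) (drop r M ++ N)
  shifted = subst₂ (Agree (length M ∸ 1)) (drop-++ˡ r N M r≤N) (drop-++ˡ r M N r≤M)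
              (agree-drop r (agree-≤ r+M-1≤ NM≈MN))
    where
    r+M-1≤ : r + (length M ∸ 1) ≤ length M + length N ∸ 2
    r+M-1≤ = subst (r + (length M ∸ 1) ≤_) (sym (+∸2 (≤-<-trans z≤n r<M) (≤-<-trans z≤n r<N)))
               (subst (_≤ (length M ∸ 1) + (length N ∸ 1)) (+-comm (length M ∸ 1) r)
                 (+-monoʳ-≤ (length M ∸ 1) (<⇒≤∸1 r<N)))

  step₁ : Agree (length M ∸ 1) (drop r N ++ M ++ Y) (drop r M ++ N ++ Y)
  step₁ = subst₂ (Agree (length M ∸ 1)) (++-assoc (drop r N) M Y) (++-assoc (drop r M) N Y)
            (agree-++ʳ _ _ Y Y M-1≤NM M-1≤MN shifted)
    where
    M-1≤NM : length M ∸ 1 ≤ length (drop r N ++ M)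
    M-1≤NM = ≤-trans (m∸n≤m (length M) 1) (length-++-≤ʳ M {drop r N})
    M-1≤MN : length M ∸ 1 ≤ length (drop r M ++ N)
    M-1≤MN = ≤-trans (m∸n≤m (length M) 1) (begin
      length M                   ≡⟨ m∸n+n≡m r≤M ⟨
      (length M ∸ r) + r         ≤⟨ +-monoʳ-≤ (length M ∸ r) r≤N ⟩
      (length M ∸ r) + length N  ≡⟨ cong (_+ length N) (length-drop r M) ⟨
      length (drop r M) + length N ≡⟨ length-++ (drop r M) ⟨
      length (drop r M ++ N)     ∎)
      where open ≤-Reasoning

  NY≈M : Agree (r ∸ 1) (N ++ Y) (take r M)
  NY≈M = begin
    take (r ∸ 1) (N ++ Y)       ≡⟨ take-++ˡ (r ∸ 1) N Y (≤-trans (m∸n≤m r 1) r≤N) ⟩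
    take (r ∸ 1) N              ≡⟨ agree-≤ (∸-monoˡ-≤ 1 r≤N) M≈N ⟨
    take (r ∸ 1) M              ≡⟨ take-take-≤ M (m∸n≤m r 1) ⟨
    take (r ∸ 1) (take r M)     ∎
    where open ≡-Reasoning

  step₂ : Agree (length M ∸ 1) (drop r M ++ N ++ Y) (rotate r M)
  step₂ = agree-≤ (subst (length M ∸ 1 ≤_) (cong (_+ (r ∸ 1)) (sym (length-drop r M))) (∸1≤∸+∸1 r≤M))
                  (agree-++ˡ (drop r M) NY≈M)
    where
    ∸1≤∸+∸1 : ∀ {r q} → r ≤ q → q ∸ 1 ≤ (q ∸ r) + (r ∸ 1)
    ∸1≤∸+∸1 {zero}  {q}     _         = ≤-trans (m∸n≤m q 1) (m≤m+n q 0)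
    ∸1≤∸+∸1 {suc r} {suc q} (s≤s r≤q) = ≤-reflexive (sym (m∸n+n≡m r≤q))

rotate-^ʷ-++-agree : ∀ (M N : Word) {A j r} → 1 ≤ A → 0 < length N →
                     Agree (length M + length N ∸ 2) (N ++ M) (M ++ N) →
                     Agree (length N ∸ 1) M N →
                     j ≤ A → r < length M → (j ≡ A → r < length N) →
                     Agree (length M ∸ 1) (rotate (j * length M + r) ((M ^ʷ A) ++ N)) (rotate r M)
rotate-^ʷ-++-agree M N 1≤A 0<N NM≈MN M≈N j≤A r<M j≡A⇒r<N with m≤n⇒m<n∨m≡n j≤A
... | inj₁ j<A  = rotate-^ʷ-++-inner M N 0<N NM≈MN j<A r<M
... | inj₂ refl = rotate-^ʷ-++-tail M N 1≤A NM≈MN M≈N r<M (j≡A⇒r<N refl)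

-- Arithmetic

quotient-bound : ∀ {t r j n A q} → t ≡ r + j * n → t < A * n + q → q ≤ n → j ≤ A × (j ≡ A → r < q)
quotient-bound {t} {r} {j} {n} {A} {q} t≡r+jn t<An+q q≤n = ≤-pred j<1+A , r<q
  where
  open ≤-Reasoning
  j<1+A : j < suc A
  j<1+A = *-cancelʳ-< n j (suc A) (begin-strict
    j * n         ≤⟨ m≤n+m (j * n) r ⟩
    r + j * n     ≡⟨ t≡r+jn ⟨
    t             <⟨ t<An+q ⟩
    A * n + q     ≤⟨ +-monoʳ-≤ (A * n) q≤n ⟩
    A * n + n     ≡⟨ +-comm (A * n) n ⟩
    suc A * n     ∎)
  r<q : j ≡ A → r < q
  r<q refl = +-cancelʳ-< (j * n) r q (subst (_< q + j * n) t≡r+jn (subst (t <_) (+-comm (j * n) q) t<An+q))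

+-*-<⇒≡ : ∀ {x y c q} → x ≡ y + c * q → x < q → c ≡ 0 × x ≡ y
+-*-<⇒≡ {y = y} {zero}  x≡y+0 _   = refl , trans x≡y+0 (+-identityʳ y)
+-*-<⇒≡ {x} {y} {suc c} {q} x≡y+q+cq x<q = ⊥-elim (<-irrefl refl (<-≤-trans x<q (begin
  q                   ≤⟨ m≤m+n q (c * q) ⟩
  q + c * q           ≤⟨ m≤n+m (q + c * q) y ⟩
  y + (q + c * q)     ≡⟨ x≡y+q+cq ⟨
  x                   ∎)))
  where open ≤-Reasoning

continuant-det-step : ∀ A x y x′ y′ → y * x′ + 1 ≡ x * y′ → (A * x + x′) * y + 1 ≡ (A * y + y′) * x
continuant-det-step A x y x′ y′ h = begin
  (A * x + x′) * y + 1    ≡⟨ solve (A ∷ x ∷ y ∷ x′ ∷ []) ⟩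
  A * x * y + (y * x′ + 1) ≡⟨ cong (A * x * y +_) h ⟩
  A * x * y + x * y′       ≡⟨ solve (A ∷ x ∷ y ∷ y′ ∷ []) ⟩
  (A * y + y′) * x         ∎
  where open ≡-Reasoning

-- Standard words

module StandardWords (a : ℕ → ℕ) (1≤a : ∀ k → 1 ≤ a (suc k)) where

  0<q : ∀ k → 0 < qd a k
  0<q zero          = s≤s z≤n
  0<q (suc zero)    = 1≤a 0
  0<q (suc (suc k)) = ≤-trans (0<q k) (m≤n+m (qd a k) _)

  q-mono : ∀ k → qd a k ≤ qd a (suc k)
  q-mono zero    = 1≤a 0
  q-mono (suc k) = ≤-trans (m≤n*m (qd a (suc k)) (a (suc (suc k))) ⦃ >-nonZero (1≤a (suc k)) ⦄)
                           (m≤m+n _ (qd a k))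

  length-M : ∀ k → length (M a k) ≡ qd a k
  length-M zero          = refl
  length-M (suc zero)    = trans (length-++ (replicate (a 1 ∸ 1) 0))
                             (trans (cong (_+ 1) (length-replicate (a 1 ∸ 1))) (m∸n+n≡m (1≤a 0)))
  length-M (suc (suc k)) = trans (length-++ (M₁ ^ʷ a₂))
                             (cong₂ _+_ (trans (length-^ʷ M₁ a₂) (cong (a₂ *_) (length-M (suc k)))) (length-M k))
    where a₂ = a (suc (suc k)); M₁ = M a (suc k)

  sum-M : ∀ k → sum (M a k) ≡ pn a k
  sum-M zero          = refl
  sum-M (suc zero)    = trans (sum-++ (replicate (a 1 ∸ 1) 0) (1 ∷ [])) (cong (_+ 1) (sum-replicate-0 (a 1 ∸ 1)))
    where
    sum-replicate-0 : ∀ c → sum (replicate c 0) ≡ 0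
    sum-replicate-0 zero    = refl
    sum-replicate-0 (suc c) = sum-replicate-0 c
  sum-M (suc (suc k)) = trans (sum-++ (M₁ ^ʷ a₂) (M a k))
                          (cong₂ _+_ (trans (sum-^ʷ M₁ a₂) (cong (a₂ *_) (sum-M (suc k)))) (sum-M k))
    where a₂ = a (suc (suc k)); M₁ = M a (suc k)

  determinant : ∀ k → qd a (suc k) * pn a k + 1 ≡ pn a (suc k) * qd a k
                    ⊎ pn a (suc k) * qd a k + 1 ≡ qd a (suc k) * pn a k
  determinant zero = inj₁ (cong (_+ 1) (*-zeroʳ (a 1)))
  determinant (suc k) with determinant k
  ... | inj₁ h = inj₂ (continuant-det-step (a (suc (suc k))) (pn a (suc k)) (qd a (suc k)) (pn a k) (qd a k) h)
  ... | inj₂ h = inj₁ (continuant-det-step (a (suc (suc k))) (qd a (suc k)) (pn a (suc k)) (qd a k) (pn a k) h)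

  coprime-q-p : ∀ k → Coprime (qd a k) (pn a k)
  coprime-q-p k {d} (d∣q , d∣p) with determinant k
  ... | inj₁ eq = ∣1⇒≡1 (∣m+n∣m⇒∣n (subst (d ∣_) (sym eq) (∣n⇒∣m*n (pn a (suc k)) d∣q))
                                   (∣n⇒∣m*n (qd a (suc k)) d∣p))
  ... | inj₂ eq = ∣1⇒≡1 (∣m+n∣m⇒∣n (subst (d ∣_) (sym eq) (∣n⇒∣m*n (qd a (suc k)) d∣p))
                                   (∣n⇒∣m*n (pn a (suc k)) d∣q))

  M-suc-agree : ∀ k → Agree (qd a k ∸ 1) (M a (suc k)) (M a k)
  M-suc-agree zero    = refl
  M-suc-agree (suc k) = take-^ʷ-++ (M a (suc k)) (M a k) (1≤a (suc k))
                          (≤-trans (m∸n≤m _ 1) (≤-reflexive (sym (length-M (suc k)))))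

  M-almost-commute : ∀ k → Agree (qd a (suc k) + qd a k ∸ 2) (M a k ++ M a (suc k)) (M a (suc k) ++ M a k)
  M-almost-commute zero =
    subst (λ n → Agree n (M a 0 ++ M a 1) (M a 1 ++ M a 0)) (cong (_∸ 2) (+-comm 1 (a 1)))
      (trans (take-replicate-++ {c = suc (a 1 ∸ 1)} 0 (1 ∷ []) (n≤1+n _))
        (sym (trans (cong (take (a 1 ∸ 1)) (++-assoc (replicate (a 1 ∸ 1) 0) (1 ∷ []) (0 ∷ [])))
                    (take-replicate-++ 0 (1 ∷ 0 ∷ []) ≤-refl))))
  M-almost-commute (suc k) =
    subst (λ n → Agree n (M₁ ++ M₂) (M₂ ++ M₁)) (sym length-eq)
      (subst₂ (Agree (length (M₁ ^ʷ a₂) + (q₁ + q₀ ∸ 2))) (sym M₁M₂≡) (sym M₂M₁≡)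
        (agree-++ˡ (M₁ ^ʷ a₂) (sym (M-almost-commute k))))
    where
    open ≡-Reasoning
    a₂ = a (suc (suc k)); M₁ = M a (suc k); M₀ = M a k; M₂ = M a (suc (suc k))
    q₁ = qd a (suc k); q₀ = qd a k
    M₁M₂≡ : M₁ ++ M₂ ≡ (M₁ ^ʷ a₂) ++ M₁ ++ M₀
    M₁M₂≡ = trans (sym (++-assoc M₁ (M₁ ^ʷ a₂) M₀))
              (trans (cong (_++ M₀) (sym (^ʷ-++-comm M₁ a₂))) (++-assoc (M₁ ^ʷ a₂) M₁ M₀))
    M₂M₁≡ : M₂ ++ M₁ ≡ (M₁ ^ʷ a₂) ++ M₀ ++ M₁
    M₂M₁≡ = ++-assoc (M₁ ^ʷ a₂) M₀ M₁
    length-eq : qd a (suc (suc k)) + q₁ ∸ 2 ≡ length (M₁ ^ʷ a₂) + (q₁ + q₀ ∸ 2)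
    length-eq = begin
      (a₂ * q₁ + q₀) + q₁ ∸ 2     ≡⟨ cong (_∸ 2) (+-assoc (a₂ * q₁) q₀ q₁) ⟩
      a₂ * q₁ + (q₀ + q₁) ∸ 2     ≡⟨ +-∸-assoc (a₂ * q₁) (+-mono-≤ (0<q k) (0<q (suc k))) ⟩
      a₂ * q₁ + (q₀ + q₁ ∸ 2)     ≡⟨ cong₂ (λ m n → m + (n ∸ 2)) (sym (cong (a₂ *_) (length-M (suc k)))) (+-comm q₀ q₁) ⟩
      a₂ * length M₁ + (q₁ + q₀ ∸ 2) ≡⟨ cong (_+ (q₁ + q₀ ∸ 2)) (length-^ʷ M₁ a₂) ⟨
      length (M₁ ^ʷ a₂) + (q₁ + q₀ ∸ 2) ∎

  M-rotate-agree : ∀ k {j r} → j ≤ a (suc (suc k)) → r < qd a (suc k) → (j ≡ a (suc (suc k)) → r < qd a k) →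
                   Agree (qd a (suc k) ∸ 1) (rotate (j * qd a (suc k) + r) (M a (suc (suc k)))) (rotate r (M a (suc k)))
  M-rotate-agree k {j} {r} j≤a₂ r<q₁ j≡a₂⇒r<q₀ =
    subst (λ q → Agree (q ∸ 1) (rotate (j * q + r) (M a (suc (suc k)))) (rotate r M₁)) (length-M (suc k))
      (rotate-^ʷ-++-agree M₁ M₀ (1≤a (suc k)) (subst (0 <_) (sym (length-M k)) (0<q k))
        commute prefix j≤a₂ (subst (r <_) (sym (length-M (suc k))) r<q₁)
        (λ j≡a₂ → subst (r <_) (sym (length-M k)) (j≡a₂⇒r<q₀ j≡a₂)))
    where
    M₁ = M a (suc k); M₀ = M a k
    commute : Agree (length M₁ + length M₀ ∸ 2) (M₀ ++ M₁) (M₁ ++ M₀)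
    commute = subst₂ (λ m n → Agree (m + n ∸ 2) (M₀ ++ M₁) (M₁ ++ M₀)) (sym (length-M (suc k))) (sym (length-M k))
                (M-almost-commute k)
    prefix : Agree (length M₀ ∸ 1) M₁ M₀
    prefix = subst (λ n → Agree (n ∸ 1) M₁ M₀) (sym (length-M k)) (M-suc-agree k)

  M-rotate-injective : ∀ k {r r′} → r < qd a k → r′ < qd a k →
                       Agree (qd a k ∸ 1) (rotate r (M a k)) (rotate r′ (M a k)) → r ≡ r′
  M-rotate-injective k {r} {r′} r<q r′<q agree =
    rotate-prefix-injective (M a k)
      (subst₂ Coprime (sym (length-M k)) (sym (sum-M k)) (coprime-q-p k))
      (subst (r <_) (sym (length-M k)) r<q) (subst (r′ <_) (sym (length-M k)) r′<q)
      (subst (λ n → Agree (n ∸ 1) (rotate r (M a k)) (rotate r′ (M a k))) (sym (length-M k)) agree)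

module Conjugates (a : ℕ → ℕ) (1≤a : ∀ k → 1 ≤ a (suc k)) (w : ℕ → ℕ) (T R : ℕ → Word)
         (split : ∀ k → 1 ≤ k → IsVSplit a w k (T k) (R k)) (T₀≡[] : T 0 ≡ []) (R₀≡0 : R 0 ≡ 0 ∷ [])
         where

  open StandardWords a 1≤a

  t : ℕ → ℕ
  t k = length (T k)

  M≡TR : ∀ k → M a k ≡ T k ++ R k
  M≡TR zero    = sym (cong₂ _++_ T₀≡[] R₀≡0)
  M≡TR (suc k) = proj₁ (split (suc k) (s≤s z≤n))

  drop-t-M : ∀ k → drop (t k) (M a k) ≡ R k
  drop-t-M k = trans (cong (drop (t k)) (M≡TR k)) (drop-length-++ (T k) (R k))

  take-t-M : ∀ k → take (t k) (M a k) ≡ T k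
  take-t-M k = trans (cong (take (t k)) (M≡TR k)) (take-length-++ (T k) (R k))

  t<q : ∀ k → t (suc k) < qd a (suc k)
  t<q k = subst (t (suc k) <_) (trans (cong length (sym (M≡TR (suc k)))) (length-M (suc k)))
            (nonempty (R (suc k)) (proj₁ (proj₂ (split (suc k) (s≤s z≤n)))))
    where
    nonempty : ∀ Rₖ → Rₖ ≢ [] → t (suc k) < length (T (suc k) ++ Rₖ)
    nonempty []       R≢[] = ⊥-elim (R≢[] refl)
    nonempty (_ ∷ Rₖ) _    = subst (t (suc k) <_) (sym (length-++ (T (suc k))))
                               (m<m+n (t (suc k)) (s≤s z≤n))

  conjugate-prefix : ∀ k {n} → n ≤ qd a (suc k) ∸ 1 → take n (rotate (t (suc k)) (M a (suc k))) ≡ applyUpTo w n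
  conjugate-prefix k {n} n≤q-1 = begin
    take n (rotate (t (suc k)) (M a (suc k)))   ≡⟨ cong (take n ∘′ rotate (t (suc k))) (M≡TR (suc k)) ⟩
    take n (rotate (t (suc k)) (T′ ++ R′))      ≡⟨ cong (take n) (rotate-length-++ T′ R′) ⟩
    take n (R′ ++ T′)                           ≡⟨ take-take-≤ (R′ ++ T′) n≤q-1 ⟨
    take n (take (qd a (suc k) ∸ 1) (R′ ++ T′)) ≡⟨ cong (take n) (proj₂ (proj₂ (split (suc k) (s≤s z≤n)))) ⟩
    take n (applyUpTo w (qd a (suc k) ∸ 1))     ≡⟨ take-applyUpTo w n≤q-1 ⟩
    applyUpTo w n                               ∎
    where
    open ≡-Reasoning
    T′ = T (suc k); R′ = R (suc k)

  t-step : ∀ k → ∃ λ j → j ≤ a (suc (suc k))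
                       × t (suc (suc k)) ≡ t (suc k) + j * qd a (suc k)
                       × (j ≡ a (suc (suc k)) → t (suc k) < qd a k)
  t-step k = j , j≤a₂ , t₂≡t₁+jq , (λ j≡a₂ → subst (_< qd a k) r≡t₁ (j≡a₂⇒r<q₀ j≡a₂))
    where
    q = qd a (suc k)
    instance
      _ : NonZero q
      _ = >-nonZero (0<q (suc k))
    t₂ = t (suc (suc k))
    j = t₂ / q
    r = t₂ % q
    t₂≡r+jq : t₂ ≡ r + j * q
    t₂≡r+jq = m≡m%n+[m/n]*n t₂ q
    j≤a₂ : j ≤ a (suc (suc k))
    j≤a₂ = proj₁ (quotient-bound t₂≡r+jq (t<q (suc k)) (q-mono k))
    j≡a₂⇒r<q₀ : j ≡ a (suc (suc k)) → r < qd a k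
    j≡a₂⇒r<q₀ = proj₂ (quotient-bound t₂≡r+jq (t<q (suc k)) (q-mono k))
    r≡t₁ : r ≡ t (suc k)
    r≡t₁ = M-rotate-injective (suc k) (m%n<n t₂ q) (t<q k) (begin
      take (q ∸ 1) (rotate r (M a (suc k)))
        ≡⟨ M-rotate-agree k j≤a₂ (m%n<n t₂ q) j≡a₂⇒r<q₀ ⟨
      take (q ∸ 1) (rotate (j * q + r) (M a (suc (suc k))))
        ≡⟨ cong (λ n → take (q ∸ 1) (rotate n (M a (suc (suc k))))) (trans (+-comm (j * q) r) (sym t₂≡r+jq)) ⟩
      take (q ∸ 1) (rotate t₂ (M a (suc (suc k))))
        ≡⟨ conjugate-prefix (suc k) (∸-monoˡ-≤ 1 (q-mono (suc k))) ⟩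
      applyUpTo w (q ∸ 1)
        ≡⟨ conjugate-prefix k ≤-refl ⟨
      take (q ∸ 1) (rotate (t (suc k)) (M a (suc k)))
        ∎)
      where open ≡-Reasoning
    t₂≡t₁+jq : t₂ ≡ t (suc k) + j * q
    t₂≡t₁+jq = trans t₂≡r+jq (cong (_+ j * q) r≡t₁)

  b : ℕ → ℕ
  b zero          = 0  -- not constrained by the statement
  b (suc zero)    = t 1
  b (suc (suc k)) = proj₁ (t-step k)

  b≤a : ∀ k → b (suc (suc k)) ≤ a (suc (suc k))
  b≤a k = proj₁ (proj₂ (t-step k))

  t-recurrence : ∀ k → t (suc (suc k)) ≡ t (suc k) + b (suc (suc k)) * qd a (suc k)
  t-recurrence k = proj₁ (proj₂ (proj₂ (t-step k)))

  b≡a⇒stationary : ∀ k → b (suc (suc k)) ≡ a (suc (suc k)) →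
                   t (suc k) < qd a k × b (suc k) ≡ 0 × t (suc k) ≡ t k
  b≡a⇒stationary zero b≡a = t₁<1 , n<1⇒n≡0 t₁<1 , trans (n<1⇒n≡0 t₁<1) (sym (cong length T₀≡[]))
    where
    t₁<1 : t 1 < 1
    t₁<1 = proj₂ (proj₂ (proj₂ (t-step zero))) b≡a
  b≡a⇒stationary (suc k) b≡a = t₂<q₁ , +-*-<⇒≡ (t-recurrence k) t₂<q₁
    where t₂<q₁ = proj₂ (proj₂ (proj₂ (t-step (suc k)))) b≡a

  T-R-from-split : ∀ k {Rest} → M a (suc (suc k)) ≡ ((M a (suc k) ^ʷ b (suc (suc k))) ++ T (suc k)) ++ Rest →
                   T (suc (suc k)) ≡ (M a (suc k) ^ʷ b (suc (suc k))) ++ T (suc k) × R (suc (suc k)) ≡ Rest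
  T-R-from-split k {Rest} M₂≡ =
    ++-injective-length (T (suc (suc k))) _ (R (suc (suc k))) Rest ∣T₂∣≡ (trans (sym (M≡TR (suc (suc k)))) M₂≡)
    where
    M₁ = M a (suc k); b₂ = b (suc (suc k))
    ∣T₂∣≡ : t (suc (suc k)) ≡ length ((M₁ ^ʷ b₂) ++ T (suc k))
    ∣T₂∣≡ = begin
      t (suc (suc k))                          ≡⟨ t-recurrence k ⟩
      t (suc k) + b₂ * qd a (suc k)            ≡⟨ +-comm (t (suc k)) _ ⟩
      b₂ * qd a (suc k) + t (suc k)            ≡⟨ cong (λ n → b₂ * n + t (suc k)) (length-M (suc k)) ⟨
      b₂ * length M₁ + t (suc k)               ≡⟨ cong (_+ t (suc k)) (length-^ʷ M₁ b₂) ⟨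
      length (M₁ ^ʷ b₂) + t (suc k)            ≡⟨ length-++ (M₁ ^ʷ b₂) ⟨
      length ((M₁ ^ʷ b₂) ++ T (suc k))         ∎
      where open ≡-Reasoning

  M-split-inner : ∀ k → b (suc (suc k)) < a (suc (suc k)) →
                  M a (suc (suc k)) ≡ ((M a (suc k) ^ʷ b (suc (suc k))) ++ T (suc k))
                                      ++ R (suc k) ++ (M a (suc k) ^ʷ (a (suc (suc k)) ∸ b (suc (suc k)) ∸ 1))
                                      ++ M a k
  M-split-inner k b<a with m≤n⇒∃[o]m+o≡n b<a
  ... | e , 1+b+e≡a₂ = begin
    (M₁ ^ʷ a₂) ++ M₀
      ≡⟨ cong (λ i → (M₁ ^ʷ i) ++ M₀) a₂≡b+1+e ⟩
    (M₁ ^ʷ (b₂ + suc e)) ++ M₀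
      ≡⟨ cong (_++ M₀) (^ʷ-+ M₁ b₂ (suc e)) ⟩
    ((M₁ ^ʷ b₂) ++ M₁ ++ (M₁ ^ʷ e)) ++ M₀
      ≡⟨ cong (λ U → ((M₁ ^ʷ b₂) ++ U ++ (M₁ ^ʷ e)) ++ M₀) (M≡TR (suc k)) ⟩
    ((M₁ ^ʷ b₂) ++ (T₁ ++ R₁) ++ (M₁ ^ʷ e)) ++ M₀
      ≡⟨ reassociate ⟩
    ((M₁ ^ʷ b₂) ++ T₁) ++ R₁ ++ (M₁ ^ʷ e) ++ M₀
      ≡⟨ cong (λ i → ((M₁ ^ʷ b₂) ++ T₁) ++ R₁ ++ (M₁ ^ʷ i) ++ M₀) e≡a₂∸b₂∸1 ⟩
    ((M₁ ^ʷ b₂) ++ T₁) ++ R₁ ++ (M₁ ^ʷ (a₂ ∸ b₂ ∸ 1)) ++ M₀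
      ∎
    where
    open ≡-Reasoning
    M₁ = M a (suc k); M₀ = M a k; T₁ = T (suc k); R₁ = R (suc k)
    a₂ = a (suc (suc k)); b₂ = b (suc (suc k))
    a₂≡b+1+e : a₂ ≡ b₂ + suc e
    a₂≡b+1+e = trans (sym 1+b+e≡a₂) (sym (+-suc b₂ e))
    e≡a₂∸b₂∸1 : e ≡ a₂ ∸ b₂ ∸ 1
    e≡a₂∸b₂∸1 = sym (cong (_∸ 1) (trans (cong (_∸ b₂) a₂≡b+1+e) (m+n∸m≡n b₂ (suc e))))
    reassociate : ((M₁ ^ʷ b₂) ++ (T₁ ++ R₁) ++ (M₁ ^ʷ e)) ++ M₀ ≡ ((M₁ ^ʷ b₂) ++ T₁) ++ R₁ ++ (M₁ ^ʷ e) ++ M₀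
    reassociate = begin
      ((M₁ ^ʷ b₂) ++ (T₁ ++ R₁) ++ (M₁ ^ʷ e)) ++ M₀  ≡⟨ ++-assoc (M₁ ^ʷ b₂) _ M₀ ⟩
      (M₁ ^ʷ b₂) ++ ((T₁ ++ R₁) ++ (M₁ ^ʷ e)) ++ M₀  ≡⟨ cong ((M₁ ^ʷ b₂) ++_) (++-assoc (T₁ ++ R₁) (M₁ ^ʷ e) M₀) ⟩
      (M₁ ^ʷ b₂) ++ (T₁ ++ R₁) ++ (M₁ ^ʷ e) ++ M₀    ≡⟨ cong ((M₁ ^ʷ b₂) ++_) (++-assoc T₁ R₁ _) ⟩
      (M₁ ^ʷ b₂) ++ T₁ ++ R₁ ++ (M₁ ^ʷ e) ++ M₀      ≡⟨ ++-assoc (M₁ ^ʷ b₂) T₁ _ ⟨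
      ((M₁ ^ʷ b₂) ++ T₁) ++ R₁ ++ (M₁ ^ʷ e) ++ M₀    ∎

  M-split-tail : ∀ k → b (suc (suc k)) ≡ a (suc (suc k)) →
                 M a (suc (suc k)) ≡ ((M a (suc k) ^ʷ b (suc (suc k))) ++ T (suc k)) ++ R k
  M-split-tail k b≡a = begin
    (M₁ ^ʷ a₂) ++ M₀                            ≡⟨ cong (λ i → (M₁ ^ʷ i) ++ M₀) (sym b≡a) ⟩
    (M₁ ^ʷ b₂) ++ M₀                            ≡⟨ cong ((M₁ ^ʷ b₂) ++_) (take++drop≡id t₁ M₀) ⟨
    (M₁ ^ʷ b₂) ++ take t₁ M₀ ++ drop t₁ M₀      ≡⟨ cong₂ (λ U V → (M₁ ^ʷ b₂) ++ U ++ V) take-t₁-M₀ drop-t₁-M₀ ⟩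
    (M₁ ^ʷ b₂) ++ T (suc k) ++ R k              ≡⟨ ++-assoc (M₁ ^ʷ b₂) (T (suc k)) (R k) ⟨
    ((M₁ ^ʷ b₂) ++ T (suc k)) ++ R k            ∎
    where
    open ≡-Reasoning
    M₁ = M a (suc k); M₀ = M a k
    a₂ = a (suc (suc k)); b₂ = b (suc (suc k))
    t₁ = t (suc k)
    stationary = b≡a⇒stationary k b≡a
    take-t₁-M₀ : take t₁ M₀ ≡ T (suc k)
    take-t₁-M₀ = trans (sym (agree-≤ (<⇒≤∸1 (proj₁ stationary)) (M-suc-agree k))) (take-t-M (suc k))
    drop-t₁-M₀ : drop t₁ M₀ ≡ R k
    drop-t₁-M₀ = trans (cong (λ n → drop n M₀) (proj₂ (proj₂ stationary))) (drop-t-M k)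

  T-recurrence : ∀ k → T (suc k) ≡ (M a k ^ʷ b (suc k)) ++ T k
  T-recurrence zero = begin
    T 1                                   ≡⟨ take-t-M 1 ⟨
    take (t 1) (replicate (a 1 ∸ 1) 0 ++ 1 ∷ [])
                                          ≡⟨ take-replicate-++ 0 (1 ∷ []) (<⇒≤∸1 (t<q 0)) ⟩
    replicate (t 1) 0                     ≡⟨ [0]^ʷ (t 1) ⟨
    ((0 ∷ []) ^ʷ t 1)                     ≡⟨ ++-identityʳ _ ⟨
    ((0 ∷ []) ^ʷ t 1) ++ []               ≡⟨ cong (((0 ∷ []) ^ʷ t 1) ++_) T₀≡[] ⟨
    ((0 ∷ []) ^ʷ t 1) ++ T 0              ∎
    where
    open ≡-Reasoning
    [0]^ʷ : ∀ n → (0 ∷ []) ^ʷ n ≡ replicate n 0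
    [0]^ʷ zero    = refl
    [0]^ʷ (suc n) = cong (0 ∷_) ([0]^ʷ n)
  T-recurrence (suc k) with m≤n⇒m<n∨m≡n (b≤a k)
  ... | inj₁ b<a = proj₁ (T-R-from-split k (M-split-inner k b<a))
  ... | inj₂ b≡a = proj₁ (T-R-from-split k (M-split-tail k b≡a))

  T-recurrence-conjugate : ∀ k → T (suc k) ≡ T k ++ ((R k ++ T k) ^ʷ b (suc k))
  T-recurrence-conjugate k = begin
    T (suc k)                              ≡⟨ T-recurrence k ⟩
    (M a k ^ʷ b (suc k)) ++ T k            ≡⟨ cong (λ W → (W ^ʷ b (suc k)) ++ T k) (M≡TR k) ⟩
    ((T k ++ R k) ^ʷ b (suc k)) ++ T k     ≡⟨ ^ʷ-conjugate (T k) (R k) (b (suc k)) ⟩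
    T k ++ ((R k ++ T k) ^ʷ b (suc k))     ∎
    where open ≡-Reasoning

lemma3p3 : (a : ℕ → ℕ) → (∀ k → 1 ≤ a (suc k))
    → (w : ℕ → ℕ) → Sturmian a w
    → (T R : ℕ → Word)
    → (∀ k → 1 ≤ k → IsVSplit a w k (T k) (R k))
    → T 0 ≡ [] → R 0 ≡ 0 ∷ []
    → Σ (ℕ → ℕ) λ b →
        (b 1 ≡ length (T 1))
      × (∀ k → 1 ≤ k → b (suc k) ≤ a (suc k)
           × length (T (suc k)) ≡ length (T k) + b (suc k) * qd a k)
      × (∀ k → 1 ≤ k → b (suc k) ≡ a (suc k)
           → length (T k) < qd a (k ∸ 1) × b k ≡ 0 × length (T k) ≡ length (T (k ∸ 1)))
      × (∀ k → T (suc k) ≡ (M a k ^ʷ b (suc k)) ++ T k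
           × T (suc k) ≡ T k ++ ((R k ++ T k) ^ʷ b (suc k)))
      × (∀ k → 1 ≤ k →
           (b (suc k) < a (suc k)
              → R (suc k) ≡ R k ++ (M a k ^ʷ (a (suc k) ∸ b (suc k) ∸ 1)) ++ M a (k ∸ 1))
         × (b (suc k) ≡ a (suc k) → R (suc k) ≡ R (k ∸ 1)))
lemma3p3 a 1≤a w _ T R split T₀≡[] R₀≡0 =
    b , refl
  , (λ { zero () ; (suc k) _ → b≤a k , t-recurrence k })
  , (λ { zero () ; (suc k) _ → b≡a⇒stationary k })
  , (λ k → T-recurrence k , T-recurrence-conjugate k)
  , (λ { zero () ; (suc k) _ → (λ b<a → proj₂ (T-R-from-split k (M-split-inner k b<a)))
                             , (λ b≡a → proj₂ (T-R-from-split k (M-split-tail k b≡a))) })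
  where open Conjugates a 1≤a w T R split T₀≡[] R₀≡0
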